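{- Let $C=c_0\dots c_{m-1}c_0$ and $D=(0)(1)\dots(n-1)(0)$ be reflexive digraph cycles with $D$ non-contractible. Let $\phi\in\mathrm{Hom}(C,D)$ and let $S$ be the vertex set of a subpath of $C$ all of whose edges are stationary under $\phi$, so that $\phi$ maps $S$ to a single vertex $d$ of $D$. If the map $\phi'$ obtained from $\phi$ by setting $\phi'(c)=d+1$ for $c\in S$ (and $\phi'(c)=\phi(c)$ otherwise) is a homomorphism, then $\phi$ and $\phi'$ are adjacent in $\mathrm{Hom}(C,D)$ (i.e. $\phi\to\phi'$ or $\phi'\to\phi$).
   Context: Digraphs are sets with a binary relation $\to$; reflexive means every vertex has a loop; a digraph cycle is one whose underlying graph is a cycle; $C$ has edges $c_ic_{i+1}$ (indices mod $m$), $D$ has vertex set $\mathbb{Z}_n$ with edges $j(j+1)$. $D$ non-contractible means it has length at least 4 or is a directed 3-cycle. $\mathrm{Hom}(C,D)$ is the digraph whose vertices are homomorphisms $C\to D$, with $\phi\to\phi'$ iff for all $u,v\in V(C)$, $u\to v$ implies $\phi(u)\to\phi'(v)$. An edge $c_ic_{i+1}$ is stationary under $\phi$ if $\phi(c_i)=\phi(c_{i+1})$. -}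

module Defs where

open import Data.Nat using (ℕ; zero; suc; _≤_; _<_)
open import Data.Nat.DivMod using (_mod_)
open import Data.Fin using (Fin; toℕ)
open import Data.Product using (_×_; ∃-syntax)
open import Data.Sum using (_⊎_)
open import Relation.Nullary using (¬_)
open import Relation.Binary.PropositionalEquality using (_≡_; _≢_)

-- Vertices of a cycle of length m are Fin m (= ℤ_m); successor mod m.
next : ∀ {m} → Fin m → Fin m
next {suc m} i = suc (toℕ i) mod suc m

next^ : ∀ {m} → ℕ → Fin m → Fin m
next^ zero    i = i
next^ (suc k) i = next (next^ k i)

Digraph : ℕ → Set₁
Digraph m = Fin m → Fin m → Set

IsReflexive : ∀ {m} → Digraph m → Set
IsReflexive E = ∀ u → E u u

-- Digraph cycle c_0 c_1 ... c_{m-1} c_0 : the underlying (simple) graph is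
-- the cycle with edges c_i c_{i+1} (indices mod m), m ≥ 3.
IsDigraphCycle : (m : ℕ) → Digraph m → Set
IsDigraphCycle m E =
  (3 ≤ m) ×
  (∀ u v → u ≢ v →
     ((E u v ⊎ E v u) → (v ≡ next u ⊎ u ≡ next v)) ×
     ((v ≡ next u ⊎ u ≡ next v) → (E u v ⊎ E v u)))

IsReflexiveDigraphCycle : (m : ℕ) → Digraph m → Set
IsReflexiveDigraphCycle m E = IsReflexive E × IsDigraphCycle m E

IsDirected3Cycle : (n : ℕ) → Digraph n → Set
IsDirected3Cycle n E =
  (n ≡ 3) ×
  (((∀ j → E j (next j)) × (∀ j → ¬ E (next j) j)) ⊎
   ((∀ j → E (next j) j) × (∀ j → ¬ E j (next j))))

NonContractible : (n : ℕ) → Digraph n → Set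
NonContractible n E = (4 ≤ n) ⊎ IsDirected3Cycle n E

IsHom : ∀ {m n} → Digraph m → Digraph n → (Fin m → Fin n) → Set
IsHom EC ED φ = ∀ u v → EC u v → ED (φ u) (φ v)

HomArc : ∀ {m n} → Digraph m → Digraph n → (Fin m → Fin n) → (Fin m → Fin n) → Set
HomArc EC ED φ ψ = ∀ u v → EC u v → ED (φ u) (ψ v)

InPath : ∀ {m} → Fin m → ℕ → Fin m → Set
InPath a ℓ c = ∃[ k ] (k ≤ ℓ × c ≡ next^ k a)

PathStationary : ∀ {m n} → (Fin m → Fin n) → Fin m → ℕ → Set
PathStationary φ a ℓ = ∀ k → k < ℓ → φ (next^ k a) ≡ φ (next^ (suc k) a)

-- The subpath S is mapped to d, and d, d+1 are adjacent in the reflexive cycle D, say d → d+1.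
-- Then φ → φ' arc by arc: an arc inside S goes to d → d+1, an arc whose head leaves S is an arc
-- of the homomorphism φ, and an arc whose head lies in S but whose tail does not is an arc of φ'.
-- If instead d+1 → d, the same argument in the reversed digraphs gives φ' → φ.
module Submission where

open import Defs
open import Data.Nat using (ℕ; zero; suc; _≤_; _<_; s≤s)
open import Data.Nat.Properties using (anyUpTo?; <⇒≤)
open import Data.Fin using (Fin; _≟_)
open import Data.Product using (_,_; proj₂)
open import Data.Sum using (_⊎_; inj₁; inj₂)
open import Function using (flip)
open import Relation.Nullary using (¬_; yes; no)
open import Relation.Nullary.Decidable using (map′)
open import Relation.Unary using (Pred; Decidable)
open import Relation.Binary.PropositionalEquality using (_≡_; refl; sym; trans; subst; subst₂)

InPath? : ∀ {m} (a : Fin m) (ℓ : ℕ) → Decidable (InPath a ℓ)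
InPath? a ℓ c =
  map′ (λ { (k , s≤s k≤ℓ , c≡) → k , k≤ℓ , c≡ })
       (λ { (k , k≤ℓ , c≡) → k , s≤s k≤ℓ , c≡ })
       (anyUpTo? (λ k → c ≟ next^ k a) (suc ℓ))

stationary⇒constant : ∀ {m n} (φ : Fin m → Fin n) (a : Fin m) (ℓ : ℕ) →
  PathStationary φ a ℓ → ∀ c → InPath a ℓ c → φ c ≡ φ a
stationary⇒constant φ a ℓ stat c (k , k≤ℓ , refl) = go k k≤ℓ
  where
  go : ∀ k → k ≤ ℓ → φ (next^ k a) ≡ φ a
  go zero    _    = refl
  go (suc k) k<ℓ = trans (sym (stat k k<ℓ)) (go k (<⇒≤ k<ℓ))

next-adjacent : ∀ {n} {ED : Digraph n} → IsReflexiveDigraphCycle n ED →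
  ∀ d → ED d (next d) ⊎ ED (next d) d
next-adjacent {ED = ED} (refl-D , _ , adj) d with d ≟ next d
... | yes d≡next = inj₁ (subst (ED d) d≡next (refl-D d))
... | no  d≢next = proj₂ (adj d (next d) d≢next) (inj₁ refl)

homArc-recolour : ∀ {m n} (EC : Digraph m) (ED : Digraph n) {p} {P : Pred (Fin m) p} →
  Decidable P → (φ φ' : Fin m → Fin n) → IsHom EC ED φ → IsHom EC ED φ' →
  ∀ {d e} → ED d e →
  (∀ c → P c → φ c ≡ d) → (∀ c → P c → φ' c ≡ e) → (∀ c → ¬ P c → φ' c ≡ φ c) →
  HomArc EC ED φ φ'
homArc-recolour EC ED P? φ φ' hom hom' d→e on-φ on-φ' off u v u→v with P? v
... | no ¬Pv = subst (ED (φ u)) (sym (off v ¬Pv)) (hom u v u→v)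
... | yes Pv with P? u
...   | yes Pu = subst₂ ED (sym (on-φ u Pu)) (sym (on-φ' v Pv)) d→e
...   | no ¬Pu = subst (λ x → ED x (φ' v)) (off u ¬Pu) (hom' u v u→v)

homArc-recolour-reversed : ∀ {m n} (EC : Digraph m) (ED : Digraph n) {p} {P : Pred (Fin m) p} →
  Decidable P → (φ φ' : Fin m → Fin n) → IsHom EC ED φ → IsHom EC ED φ' →
  ∀ {d e} → ED e d →
  (∀ c → P c → φ c ≡ d) → (∀ c → P c → φ' c ≡ e) → (∀ c → ¬ P c → φ' c ≡ φ c) →
  HomArc EC ED φ' φ
homArc-recolour-reversed EC ED P? φ φ' hom hom' e→d on-φ on-φ' off u v u→v =
  homArc-recolour (flip EC) (flip ED) P? φ φ'
    (λ x y → hom y x) (λ x y → hom' y x) e→d on-φ on-φ' off v u u→v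

lemma2p1 : (m n : ℕ) (EC : Digraph m) (ED : Digraph n) →
    IsReflexiveDigraphCycle m EC → IsReflexiveDigraphCycle n ED →
    NonContractible n ED →
    (φ : Fin m → Fin n) → IsHom EC ED φ →
    (a : Fin m) (ℓ : ℕ) → ℓ < m → PathStationary φ a ℓ →
    (φ' : Fin m → Fin n) →
    (∀ c → InPath a ℓ c → φ' c ≡ next (φ a)) →
    (∀ c → ¬ InPath a ℓ c → φ' c ≡ φ c) →
    IsHom EC ED φ' →
    HomArc EC ED φ φ' ⊎ HomArc EC ED φ' φ
lemma2p1 m n EC ED _ cycle-D _ φ hom a ℓ _ stat φ' on-S off-S hom' =
  compare (next-adjacent cycle-D (φ a))
  where
  on-S-φ : ∀ c → InPath a ℓ c → φ c ≡ φ a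
  on-S-φ = stationary⇒constant φ a ℓ stat

  compare : ED (φ a) (next (φ a)) ⊎ ED (next (φ a)) (φ a) →
            HomArc EC ED φ φ' ⊎ HomArc EC ED φ' φ
  compare (inj₁ d→d+1) =
    inj₁ (homArc-recolour EC ED (InPath? a ℓ) φ φ' hom hom' d→d+1 on-S-φ on-S off-S)
  compare (inj₂ d+1→d) =
    inj₂ (homArc-recolour-reversed EC ED (InPath? a ℓ) φ φ' hom hom' d+1→d on-S-φ on-S off-S)
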